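{- Let $3 \le p \le q$ and let $D$ be a strong orientation of $K(3,p,q)$ with parts $V_1=\{x_1,x_2,x_3\}$, $V_2$ ($|V_2|=p$), $V_3$ ($|V_3|=q$). If $V_2 = V_2^A$ for some nonempty proper subset $A$ of $\{1,2,3\}$, then $\mathrm{diam}(D) \ge 3$.
   Context: $K(3,p,q)$ is the complete tripartite graph with parts $V_1=\{x_1,x_2,x_3\}$, $V_2$ of size $p$, $V_3$ of size $q$. A strong orientation is an orientation of all edges making the digraph strongly connected; $\mathrm{diam}(D)$ is the maximum directed distance between ordered pairs of vertices. Write $u\to v$ if the edge $uv$ is oriented from $u$ to $v$. For $A \subseteq [3]=\{1,2,3\}$, let $N_D^A$ be the set of vertices $w$ such that $x_i \to w$ for all $i \in A$ and $w \to x_j$ for all $j \in [3]\setminus A$, and $V_2^A = V_2 \cap N_D^A$. -}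

module Defs where

open import Data.Nat using (ℕ; zero; suc; _≤_)
open import Data.Fin using (Fin)
open import Data.Bool using (Bool; true; false; not)
open import Data.Sum using (_⊎_; inj₁; inj₂)
open import Data.Product using (Σ; ∃; _×_; _,_)
open import Data.Empty using (⊥)
open import Data.Unit using (⊤)
open import Relation.Binary.PropositionalEquality using (_≡_)
open import Relation.Nullary using (¬_)

Vtx : ℕ → ℕ → Set
Vtx p q = Fin 3 ⊎ (Fin p ⊎ Fin q)

x : ∀ {p q} → Fin 3 → Vtx p q
x i = inj₁ i

v₂ : ∀ {p q} → Fin p → Vtx p q
v₂ w = inj₂ (inj₁ w)

v₃ : ∀ {p q} → Fin q → Vtx p q
v₃ w = inj₂ (inj₂ w)

-- An orientation of K(3,p,q): for every edge (between distinct parts) a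
-- choice of direction.  o12 i w = true means x_i → w (w ∈ V2), false means
-- w → x_i; similarly o13 for V1–V3 edges and o23 for V2–V3 edges
-- (o23 a b = true means a → b with a ∈ V2, b ∈ V3).
record Orientation (p q : ℕ) : Set where
  field
    o12 : Fin 3 → Fin p → Bool
    o13 : Fin 3 → Fin q → Bool
    o23 : Fin p → Fin q → Bool

open Orientation public

Arc : ∀ {p q} → Orientation p q → Vtx p q → Vtx p q → Set
Arc D (inj₁ i)         (inj₂ (inj₁ w)) = o12 D i w ≡ true
Arc D (inj₂ (inj₁ w))  (inj₁ i)        = o12 D i w ≡ false
Arc D (inj₁ i)         (inj₂ (inj₂ w)) = o13 D i w ≡ true
Arc D (inj₂ (inj₂ w))  (inj₁ i)        = o13 D i w ≡ false
Arc D (inj₂ (inj₁ a))  (inj₂ (inj₂ b)) = o23 D a b ≡ true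
Arc D (inj₂ (inj₂ b))  (inj₂ (inj₁ a)) = o23 D a b ≡ false
Arc D (inj₁ _)         (inj₁ _)        = ⊥
Arc D (inj₂ (inj₁ _))  (inj₂ (inj₁ _)) = ⊥
Arc D (inj₂ (inj₂ _))  (inj₂ (inj₂ _)) = ⊥

data Walk {p q} (D : Orientation p q) : Vtx p q → Vtx p q → ℕ → Set where
  here : ∀ {u} → Walk D u u zero
  step : ∀ {u v w n} → Arc D u v → Walk D v w n → Walk D u w (suc n)

DistLe : ∀ {p q} → Orientation p q → Vtx p q → Vtx p q → ℕ → Set
DistLe D u v k = ∃ λ n → n ≤ k × Walk D u v n

Strong : ∀ {p q} → Orientation p q → Set
Strong D = ∀ u v → ∃ λ n → Walk D u v n

-- diam(D) ≥ k+1 : some ordered pair has distance > k.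
DiamGt : ∀ {p q} → Orientation p q → ℕ → Set
DiamGt D k = ∃ λ u → ∃ λ v → ¬ DistLe D u v k

Subset3 : Set
Subset3 = Fin 3 → Bool

NonemptyProper : Subset3 → Set
NonemptyProper A = (∃ λ i → A i ≡ true) × (∃ λ j → A j ≡ false)

InN : ∀ {p q} → Orientation p q → Subset3 → Vtx p q → Set
InN D A w = ∀ i → (A i ≡ true → Arc D (x i) w) × (A i ≡ false → Arc D w (x i))

-- V_2 = V_2^A : every vertex of V_2 lies in N_D^A.
V₂⊆N : ∀ {p q} → Orientation p q → Subset3 → Set
V₂⊆N D A = ∀ w → InN D A (v₂ w)

{-# OPTIONS --safe #-}
-- Two of x₁, x₂, x₃, say x_j and x_k, lie on the same side of A, so no vertex of
-- V₂ can be the middle vertex of a 2-path from x_j to x_k.  Either no vertex y of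
-- V₃ has x_j → y → x_k, and then d(x_j, x_k) ≥ 3, or such a y exists; then if
-- x_j ∈ A, we have x_j → y and no vertex of V₂ points to x_j, so d(y, x_j) ≥ 3,
-- and if x_k ∉ A dually d(x_k, y) ≥ 3.
module Submission where

open import Defs
open import Data.Nat using (ℕ; _≤_; zero; suc; s≤s)
open import Data.Fin.Patterns using (0F; 1F; 2F)
open import Data.Fin.Properties using (any?)
open import Data.Bool using (true; false)
open import Data.Bool.Properties using (_≟_; ¬-not)
open import Data.Product using (∃; ∃₂; _×_; _,_; proj₁; proj₂)
open import Data.Sum using (inj₁; inj₂)
open import Relation.Nullary using (¬_; yes; no)
open import Relation.Nullary.Decidable using (_×-dec_)
open import Relation.Binary.PropositionalEquality using (_≡_; _≢_; refl; sym; trans)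

same-side-pair : (A : Subset3) → ∃₂ λ j k → j ≢ k × A j ≡ A k
same-side-pair A with A 1F ≟ A 0F | A 2F ≟ A 0F
... | yes A₁≡A₀ | _         = 1F , 0F , (λ ()) , A₁≡A₀
... | no _      | yes A₂≡A₀ = 2F , 0F , (λ ()) , A₂≡A₀
... | no A₁≢A₀  | no A₂≢A₀  = 1F , 2F , (λ ()) , trans (¬-not A₁≢A₀) (sym (¬-not A₂≢A₀))

true≢false-at : ∀ {b} → b ≡ true → b ≢ false
true≢false-at refl ()

module _ {p q : ℕ} {D : Orientation p q} where

  arc-asym : ∀ {u v} → Arc D u v → ¬ Arc D v u
  arc-asym {inj₁ _}         {inj₂ (inj₁ _)} a b = true≢false-at a b
  arc-asym {inj₁ _}         {inj₂ (inj₂ _)} a b = true≢false-at a b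
  arc-asym {inj₂ (inj₁ _)}  {inj₁ _}        a b = true≢false-at b a
  arc-asym {inj₂ (inj₁ _)}  {inj₂ (inj₂ _)} a b = true≢false-at a b
  arc-asym {inj₂ (inj₂ _)}  {inj₁ _}        a b = true≢false-at b a
  arc-asym {inj₂ (inj₂ _)}  {inj₂ (inj₁ _)} a b = true≢false-at b a

  data Walk≤2 : Vtx p q → Vtx p q → Set where
    stay   : ∀ {u} → Walk≤2 u u
    direct : ∀ {u v} → Arc D u v → Walk≤2 u v
    via    : ∀ {u v} m → Arc D u m → Arc D m v → Walk≤2 u v

  distLe2⇒walk≤2 : ∀ {u v} → DistLe D u v 2 → Walk≤2 u v
  distLe2⇒walk≤2 (zero , _ , here)                           = stay
  distLe2⇒walk≤2 (suc zero , _ , step a here)                = direct a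
  distLe2⇒walk≤2 (suc (suc zero) , _ , step a (step b here)) = via _ a b
  distLe2⇒walk≤2 (suc (suc (suc _)) , s≤s (s≤s ()) , _)

  module _ {A : Subset3} (w : Vtx p q) (w∈N : InN D A w) where

    N-no-arc-to-A : ∀ {i} → A i ≡ true → ¬ Arc D w (x i)
    N-no-arc-to-A Ai = arc-asym {x _} {w} (proj₁ (w∈N _) Ai)

    N-no-arc-from-outside-A : ∀ {i} → A i ≡ false → ¬ Arc D (x i) w
    N-no-arc-from-outside-A Ai a = arc-asym {x _} {w} a (proj₂ (w∈N _) Ai)

    N-no-transit : ∀ {j k} → A j ≡ A k → Arc D (x j) w → ¬ Arc D w (x k)
    N-no-transit {j} Aj≡Ak a with A j in Aj
    ... | true  = N-no-arc-to-A (sym Aj≡Ak)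
    ... | false = λ _ → N-no-arc-from-outside-A Aj a

  module _ {A : Subset3} (V₂⊆Nᴬ : V₂⊆N D A) where

    far-x-x : ∀ {j k} → j ≢ k → A j ≡ A k →
      ¬ (∃ λ y → Arc D (x j) (v₃ y) × Arc D (v₃ y) (x k)) → ¬ DistLe D (x j) (x k) 2
    far-x-x j≢k Aj≡Ak no-y d with distLe2⇒walk≤2 d
    ... | stay = j≢k refl
    ... | via (inj₂ (inj₁ w)) a b = N-no-transit (v₂ w) (V₂⊆Nᴬ w) Aj≡Ak a b
    ... | via (inj₂ (inj₂ y)) a b = no-y (y , a , b)

    far-v₃-x : ∀ {j y} → A j ≡ true → Arc D (x j) (v₃ y) → ¬ DistLe D (v₃ y) (x j) 2
    far-v₃-x {j} {y} Aj a d with distLe2⇒walk≤2 d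
    ... | direct b = arc-asym {x j} {v₃ y} a b
    ... | via (inj₂ (inj₁ w)) _ b = N-no-arc-to-A (v₂ w) (V₂⊆Nᴬ w) Aj b

    far-x-v₃ : ∀ {k y} → A k ≡ false → Arc D (v₃ y) (x k) → ¬ DistLe D (x k) (v₃ y) 2
    far-x-v₃ {k} {y} Ak b d with distLe2⇒walk≤2 d
    ... | direct a = arc-asym {x k} {v₃ y} a b
    ... | via (inj₂ (inj₁ w)) a _ = N-no-arc-from-outside-A (v₂ w) (V₂⊆Nᴬ w) Ak a

    diam>2-of-same-side : ∀ {j k} → j ≢ k → A j ≡ A k → DiamGt D 2
    diam>2-of-same-side {j} {k} j≢k Aj≡Ak
      with any? (λ y → (o13 D j y ≟ true) ×-dec (o13 D k y ≟ false))
    ... | no no-y = x j , x k , far-x-x j≢k Aj≡Ak no-y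
    ... | yes (y , a , b) with A j in Aj
    ...   | true  = v₃ y , x j , far-v₃-x Aj a
    ...   | false = x k , v₃ y , far-x-v₃ (sym Aj≡Ak) b

lemma4p2 : (p q : ℕ) → 3 ≤ p → p ≤ q → (D : Orientation p q) → Strong D →
    (∃ λ A → NonemptyProper A × V₂⊆N D A) → DiamGt D 2
lemma4p2 _ _ _ _ _ _ (A , _ , V₂⊆Nᴬ) with same-side-pair A
... | _ , _ , j≢k , Aj≡Ak = diam>2-of-same-side V₂⊆Nᴬ j≢k Aj≡Ak
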